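{- Let $G$ be a graph on vertex set $[n]$ and $\ell\ge 1$ an integer. Define $\hat y=(\hat y_A)_{A\subseteq[n]}$ by $\hat y_\emptyset=1$, $\hat y_A=\frac{1}{\omega(G)+\ell}$ if $|A|=1$, and $\hat y_A=0$ if $|A|\ge 2$. Then $\hat y$ is a feasible solution of $\mathrm{SA}^+_\ell(G)$.
   Context: $\mathrm{SA}^+_\ell(G)$ is the linear program in variables $y_A$, $A\subseteq[n]$: maximize $\sum_{i\in[n]} y_{\{i\}}$ subject to $y_\emptyset=1$ and, for all $S,T\subseteq[n]$ with $S\cap T=\emptyset$ and $|S\cup T|\le\ell$: (i) for every clique $Q$ of $G$, $\sum_{T'\subseteq T}(-1)^{|T'|}y_{S\cup T'}-\sum_{i\in Q}\sum_{T'\subseteq T}(-1)^{|T'|}y_{S\cup T'\cup\{i\}}\ge 0$; (ii) $\sum_{T'\subseteq T}(-1)^{|T'|}y_{S\cup T'}\ge 0$; (iii) for every $i\in[n]$, $\sum_{T'\subseteq T}(-1)^{|T'|}y_{S\cup T'\cup\{i\}}\ge 0$. $\omega(G)$ is the clique number of $G$. -}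

module Defs where

open import Data.Nat as ℕ using (ℕ; zero; suc; NonZero)
open import Data.Fin using (Fin)
open import Data.Fin.Subset using (Subset; inside; outside; ⊥; ⁅_⁆; _∈_; _∪_; _∩_; ∣_∣)
open import Data.Fin.Subset.Properties using (_∈?_)
open import Data.List using (List; []; _∷_; map; _++_; foldr; filter; allFin)
open import Data.Vec using ([]; _∷_)
open import Data.Bool using (Bool; true; false)
open import Data.Product using (_×_; ∃-syntax)
open import Data.Integer using (+_)
open import Data.Rational using (ℚ; 0ℚ; 1ℚ; _+_; _-_; _*_; -_; _≤_; _/_)
open import Relation.Binary.PropositionalEquality using (_≡_; _≢_)

record Graph (n : ℕ) : Set where
  field
    adj     : Fin n → Fin n → Bool
    adj-sym : ∀ i j → adj i j ≡ adj j i
    irrefl  : ∀ i → adj i i ≡ false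
open Graph public

IsClique : ∀ {n} → Graph n → Subset n → Set
IsClique G Q = ∀ i j → i ∈ Q → j ∈ Q → i ≢ j → adj G i j ≡ true

IsCliqueNumber : ∀ {n} → Graph n → ℕ → Set
IsCliqueNumber G ω =
  (∃[ Q ] (IsClique G Q × ∣ Q ∣ ≡ ω)) × (∀ Q → IsClique G Q → ∣ Q ∣ ℕ.≤ ω)

sumℚ : List ℚ → ℚ
sumℚ = foldr _+_ 0ℚ

sgn : ℕ → ℚ
sgn zero    = 1ℚ
sgn (suc k) = - sgn k

subsetsOf : ∀ {n} → Subset n → List (Subset n)
subsetsOf []            = [] ∷ []
subsetsOf (outside ∷ T) = map (outside ∷_) (subsetsOf T)
subsetsOf (inside ∷ T)  = map (outside ∷_) (subsetsOf T) ++ map (inside ∷_) (subsetsOf T)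

alt : ∀ {n} → (Subset n → ℚ) → Subset n → Subset n → ℚ
alt y S T = sumℚ (map (λ T' → sgn ∣ T' ∣ * y (S ∪ T')) (subsetsOf T))

altᵢ : ∀ {n} → (Subset n → ℚ) → Subset n → Subset n → Fin n → ℚ
altᵢ y S T i = sumℚ (map (λ T' → sgn ∣ T' ∣ * y ((S ∪ T') ∪ ⁅ i ⁆)) (subsetsOf T))

sumOver : ∀ {n} → Subset n → (Fin n → ℚ) → ℚ
sumOver {n} Q f = sumℚ (map f (filter (_∈? Q) (allFin n)))

FeasibleSA⁺ : ∀ {n} → ℕ → Graph n → (Subset n → ℚ) → Set
FeasibleSA⁺ {n} ℓ G y =
  y ⊥ ≡ 1ℚ ×
  (∀ (S T : Subset n) → S ∩ T ≡ ⊥ → ∣ S ∪ T ∣ ℕ.≤ ℓ →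
     (∀ Q → IsClique G Q → 0ℚ ≤ alt y S T - sumOver Q (altᵢ y S T))
     × 0ℚ ≤ alt y S T
     × (∀ i → 0ℚ ≤ altᵢ y S T i))

+-nonZero : ∀ m ℓ → {{NonZero ℓ}} → NonZero (m ℕ.+ ℓ)
+-nonZero zero    ℓ {{nz}} = nz
+-nonZero (suc m) ℓ        = _

ŷ : ∀ {n} (ω ℓ : ℕ) → .{{NonZero ℓ}} → Subset n → ℚ
ŷ ω ℓ A with ∣ A ∣
... | zero        = 1ℚ
... | suc zero    = _/_ (+ 1) (ω ℕ.+ ℓ) {{+-nonZero ω ℓ}}
... | suc (suc _) = 0ℚ

module Submission where

-- ŷ_A = g(|A|) for the profile g(0) = 1, g(1) = c, g(k) = 0 (k ≥ 2), where c = 1/(ω+ℓ).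
-- For S ∩ T = ∅ the alternating sum Σ_{T' ⊆ T} (-1)^|T'| g(|S ∪ T'|) is the |T|-th finite
-- difference of g at |S|, namely 1 - |T|c, c or 0 according as |S| = 0, 1 or ≥ 2.  With an extra
-- vertex i the sum vanishes if i ∈ T (T' and T' ∪ {i} cancel) and is that difference at
-- |S ∪ {i}| otherwise.  Since |T| ≤ ℓ all these values are nonnegative and at most c, and the
-- clique inequality becomes |Q|c + |T|c ≤ (ω+ℓ)c = 1 when S = ∅; when |S| = 1 only i ∈ S
-- contributes to the clique sum, and when |S| ≥ 2 everything is 0.

open import Defs
open import Data.Nat as ℕ using (ℕ; zero; suc; NonZero; z≤n; s≤s)
import Data.Nat.Properties as ℕP
import Data.Nat.Coprimality as Coprime
open import Data.Integer as ℤ using (+_)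
import Data.Integer.Properties as ℤP
open import Data.Rational using (ℚ; mkℚ; 0ℚ; 1ℚ; _+_; _-_; _*_; -_; _/_; 1/_; _≤_)
import Data.Rational.Properties as ℚP
open import Data.Rational.Solver using (module +-*-Solver)
open import Algebra.Bundles using (Ring)
open import Algebra.Properties.Semiring.Mult (Ring.semiring ℚP.+-*-ring)
  using (_×_; ×-homo-1; ×-homo-+; ×-assoc-*)
open import Data.Fin using (Fin; zero; suc)
open import Data.Fin.Subset using (Subset; inside; outside; ⊥; ⁅_⁆; _∈_; _∉_; _∪_; ∣_∣)
open import Data.Fin.Subset.Properties
  using (_∈?_; drop-there; ∉⊥; ∣⊥∣≡0; x∈⁅x⁆; x∈⁅y⁆⇒x≡y; ∣⁅x⁆∣≡1; x∈p∩q⁺; x∈p∪q⁺; x∈p∪q⁻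
        ; p⊆p∪q; p⊂q⇒∣p∣<∣q∣; ∣p∣≤∣p∪q∣; ∣q∣≤∣p∪q∣; ∪-assoc; ∪-comm)
open import Data.Vec using ([]; _∷_; here; there)
open import Data.List using ([]; _∷_; map; _++_; filter; allFin; tabulate)
import Data.List.Properties as ListP
open import Data.Bool using (false; true; _∨_)
open import Data.Product using (_,_)
open import Data.Sum using (_⊎_; inj₁; inj₂; [_,_])
open import Data.Empty using (⊥-elim)
open import Function using (_∘_; id)
open import Relation.Nullary using (yes; no)
open import Relation.Binary.PropositionalEquality
  using (_≡_; refl; sym; trans; cong; cong₂; subst; subst₂; module ≡-Reasoning)

open +-*-Solver using (solve; _:+_; _:-_; _:=_; con)

p+q≤r⇒p≤r-q : ∀ {p q r} → p + q ≤ r → p ≤ r - q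
p+q≤r⇒p≤r-q {p} {q} {r} p+q≤r =
  subst (_≤ r - q) (solve 2 (λ p q → (p :+ q) :- q := p) refl p q) (ℚP.+-monoˡ-≤ (- q) p+q≤r)

p≤q⇒0≤q-p : ∀ {p q} → p ≤ q → 0ℚ ≤ q - p
p≤q⇒0≤q-p {p} p≤q = p+q≤r⇒p≤r-q (subst (_≤ _) (sym (ℚP.+-identityˡ p)) p≤q)

×-zeroʳ : ∀ n → n × 0ℚ ≡ 0ℚ
×-zeroʳ zero    = refl
×-zeroʳ (suc n) = trans (ℚP.+-identityˡ (n × 0ℚ)) (×-zeroʳ n)

×-nonNeg : ∀ {c} n → 0ℚ ≤ c → 0ℚ ≤ n × c
×-nonNeg zero    0≤c = ℚP.≤-refl
×-nonNeg (suc n) 0≤c = ℚP.+-mono-≤ 0≤c (×-nonNeg n 0≤c)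

×-monoˡ-≤ : ∀ {c m n} → 0ℚ ≤ c → m ℕ.≤ n → m × c ≤ n × c
×-monoˡ-≤     0≤c (z≤n {n}) = ×-nonNeg n 0≤c
×-monoˡ-≤ {c} 0≤c (s≤s m≤n) = ℚP.+-monoʳ-≤ c (×-monoˡ-≤ 0≤c m≤n)

×-inverse : ∀ m .{{_ : NonZero m}} → m × (+ 1 / m) ≡ 1ℚ
×-inverse (suc k) = begin
  suc k × (+ 1 / suc k)          ≡⟨ cong (suc k ×_) (sym (ℚP.*-identityˡ (+ 1 / suc k))) ⟩
  suc k × (1ℚ * (+ 1 / suc k))   ≡⟨ sym (×-assoc-* (suc k) 1ℚ (+ 1 / suc k)) ⟩
  (suc k × 1ℚ) * (+ 1 / suc k)   ≡⟨ cong₂ _*_ (×1ℚ≡ (suc k))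
                                        (ℚP.normalize-coprime (Coprime.1-coprimeTo (suc k))) ⟩
  fromℕ (suc k) * 1/ fromℕ (suc k) ≡⟨ ℚP.*-inverseʳ (fromℕ (suc k)) ⟩
  1ℚ                             ∎
  where
  open ≡-Reasoning
  fromℕ : ℕ → ℚ
  fromℕ m = mkℚ (+ m) 0 (Coprime.sym (Coprime.1-coprimeTo m))

  ×1ℚ≡ : ∀ m → m × 1ℚ ≡ fromℕ m
  ×1ℚ≡ zero    = refl
  ×1ℚ≡ (suc m) = begin
    1ℚ + m × 1ℚ     ≡⟨ cong (_+_ 1ℚ) (×1ℚ≡ m) ⟩
    1ℚ + fromℕ m    ≡⟨ ℚP./-cong (cong (ℤ._+_ (+ 1)) (ℤP.*-identityʳ (+ m))) refl ⟩
    + suc m / 1     ≡⟨ ℚP.normalize-coprime (Coprime.sym (Coprime.1-coprimeTo (suc m))) ⟩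
    fromℕ (suc m)   ∎

Δ : ℕ → (ℕ → ℚ) → ℕ → ℚ
Δ zero    h a = h a
Δ (suc t) h a = Δ t h a - Δ t h (suc a)

Δ-shift : ∀ t (h : ℕ → ℚ) a → Δ t (h ∘ suc) a ≡ Δ t h (suc a)
Δ-shift zero    h a = refl
Δ-shift (suc t) h a = cong₂ _-_ (Δ-shift t h a) (Δ-shift t h (suc a))

profile : ℚ → ℕ → ℚ
profile c zero          = 1ℚ
profile c (suc zero)    = c
profile c (suc (suc _)) = 0ℚ

module _ {c : ℚ} where

  Δ-profile-≥2 : ∀ t {a} → 2 ℕ.≤ a → Δ t (profile c) a ≡ 0ℚ
  Δ-profile-≥2 zero    (s≤s (s≤s _)) = refl
  Δ-profile-≥2 (suc t) 2≤a           =
    cong₂ _-_ (Δ-profile-≥2 t 2≤a) (Δ-profile-≥2 t (ℕP.m≤n⇒m≤1+n 2≤a))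

  Δ-profile-1 : ∀ t → Δ t (profile c) 1 ≡ c
  Δ-profile-1 zero    = refl
  Δ-profile-1 (suc t) =
    trans (cong₂ _-_ (Δ-profile-1 t) (Δ-profile-≥2 t ℕP.≤-refl)) (ℚP.+-identityʳ c)

  Δ-profile-0 : ∀ t → Δ t (profile c) 0 ≡ 1ℚ - t × c
  Δ-profile-0 zero    = refl
  Δ-profile-0 (suc t) = trans (cong₂ _-_ (Δ-profile-0 t) (Δ-profile-1 t))
    (solve 2 (λ x c → (con 1ℚ :- x) :- c := con 1ℚ :- (c :+ x)) refl (t × c) c)

  Δ-profile-≤ : 0ℚ ≤ c → ∀ t {a} → 1 ℕ.≤ a → Δ t (profile c) a ≤ c
  Δ-profile-≤ 0≤c t {suc zero}    _ = ℚP.≤-reflexive (Δ-profile-1 t)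
  Δ-profile-≤ 0≤c t {suc (suc a)} _ =
    subst (_≤ c) (sym (Δ-profile-≥2 t (s≤s (s≤s z≤n)))) 0≤c

  Δ-profile-nonNeg : 0ℚ ≤ c → ∀ t → t × c ≤ 1ℚ → ∀ a → 0ℚ ≤ Δ t (profile c) a
  Δ-profile-nonNeg 0≤c t tc≤1 zero        = subst (0ℚ ≤_) (sym (Δ-profile-0 t)) (p≤q⇒0≤q-p tc≤1)
  Δ-profile-nonNeg 0≤c t tc≤1 (suc zero)  = subst (0ℚ ≤_) (sym (Δ-profile-1 t)) 0≤c
  Δ-profile-nonNeg 0≤c t tc≤1 (suc (suc a)) =
    ℚP.≤-reflexive (sym (Δ-profile-≥2 t (s≤s (s≤s z≤n))))

sumℚ-++ : ∀ xs ys → sumℚ (xs ++ ys) ≡ sumℚ xs + sumℚ ys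
sumℚ-++ []       ys = sym (ℚP.+-identityˡ (sumℚ ys))
sumℚ-++ (x ∷ xs) ys = trans (cong (_+_ x) (sumℚ-++ xs ys)) (sym (ℚP.+-assoc x (sumℚ xs) (sumℚ ys)))

sumℚ-neg : ∀ {A : Set} (f : A → ℚ) xs → sumℚ (map (λ x → - f x) xs) ≡ - sumℚ (map f xs)
sumℚ-neg f []       = refl
sumℚ-neg f (x ∷ xs) = trans (cong (_+_ (- f x)) (sumℚ-neg f xs)) (sym (ℚP.neg-distrib-+ (f x) _))

alt-cong : ∀ {n} {y y′ : Subset n → ℚ} → (∀ A → y A ≡ y′ A) → ∀ S T → alt y S T ≡ alt y′ S T
alt-cong y≗y′ S T =
  cong sumℚ (ListP.map-cong (λ U → cong (sgn ∣ U ∣ *_) (y≗y′ (S ∪ U))) (subsetsOf T))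

alt-∪ʳ : ∀ {n} (y : Subset n → ℚ) S T R → alt (λ B → y (B ∪ R)) S T ≡ alt y (S ∪ R) T
alt-∪ʳ y S T R =
  cong sumℚ (ListP.map-cong (λ U → cong (λ B → sgn ∣ U ∣ * y B) (swap U)) (subsetsOf T))
  where
  swap : ∀ U → (S ∪ U) ∪ R ≡ (S ∪ R) ∪ U
  swap U = trans (∪-assoc S U R) (trans (cong (S ∪_) (∪-comm U R)) (sym (∪-assoc S R U)))

alt-∷-outside : ∀ {n} (y : Subset (suc n) → ℚ) s S T →
  alt y (s ∷ S) (outside ∷ T) ≡ alt (λ B → y ((s ∨ false) ∷ B)) S T
alt-∷-outside y s S T = cong sumℚ (sym (ListP.map-∘ (subsetsOf T)))

alt-∷-inside : ∀ {n} (y : Subset (suc n) → ℚ) s S T →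
  alt y (s ∷ S) (inside ∷ T) ≡ alt (λ B → y ((s ∨ false) ∷ B)) S T - alt (λ B → y ((s ∨ true) ∷ B)) S T
alt-∷-inside y s S T = begin
  sumℚ (map term (map (outside ∷_) Us ++ map (inside ∷_) Us))
    ≡⟨ cong sumℚ (ListP.map-++ term (map (outside ∷_) Us) (map (inside ∷_) Us)) ⟩
  sumℚ (map term (map (outside ∷_) Us) ++ map term (map (inside ∷_) Us))
    ≡⟨ sumℚ-++ (map term (map (outside ∷_) Us)) (map term (map (inside ∷_) Us)) ⟩
  sumℚ (map term (map (outside ∷_) Us)) + sumℚ (map term (map (inside ∷_) Us))
    ≡⟨ cong₂ _+_ (cong sumℚ (sym (ListP.map-∘ Us))) (cong sumℚ (sym (ListP.map-∘ Us))) ⟩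
  alt y₀ S T + sumℚ (map (λ U → - sgn ∣ U ∣ * y₁ (S ∪ U)) Us)
    ≡⟨ cong (_+_ (alt y₀ S T)) (trans
         (cong sumℚ (ListP.map-cong (λ U → sym (ℚP.neg-distribˡ-* (sgn ∣ U ∣) (y₁ (S ∪ U)))) Us))
         (sumℚ-neg (λ U → sgn ∣ U ∣ * y₁ (S ∪ U)) Us)) ⟩
  alt y₀ S T - alt y₁ S T ∎
  where
  open ≡-Reasoning
  Us = subsetsOf T
  term = λ U → sgn ∣ U ∣ * y ((s ∷ S) ∪ U)
  y₀ = λ B → y ((s ∨ false) ∷ B)
  y₁ = λ B → y ((s ∨ true) ∷ B)

alt-vanishes : ∀ {n} (y : Subset n → ℚ) S T {i} → i ∈ S → i ∈ T → alt y S T ≡ 0ℚ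
alt-vanishes y (inside ∷ S) (inside ∷ T) here here =
  trans (alt-∷-inside y inside S T) (ℚP.+-inverseʳ (alt (λ B → y (inside ∷ B)) S T))
alt-vanishes y (s ∷ S) (outside ∷ T) (there i∈S) (there i∈T) =
  trans (alt-∷-outside y s S T) (alt-vanishes (λ B → y ((s ∨ false) ∷ B)) S T i∈S i∈T)
alt-vanishes y (s ∷ S) (inside ∷ T) (there i∈S) (there i∈T) =
  trans (alt-∷-inside y s S T)
    (cong₂ _-_ (alt-vanishes (λ B → y ((s ∨ false) ∷ B)) S T i∈S i∈T)
               (alt-vanishes (λ B → y ((s ∨ true) ∷ B)) S T i∈S i∈T))

drop-disjoint : ∀ {n s t} {S T : Subset n} →
  (∀ {x} → x ∈ s ∷ S → x ∉ t ∷ T) → ∀ {x} → x ∈ S → x ∉ T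
drop-disjoint S∩T=∅ x∈S x∈T = S∩T=∅ (there x∈S) (there x∈T)

alt-card : ∀ {n} (h : ℕ → ℚ) (S T : Subset n) → (∀ {x} → x ∈ S → x ∉ T) →
  alt (λ B → h ∣ B ∣) S T ≡ Δ (∣ T ∣) h ∣ S ∣
alt-card h []            []            _ = trans (ℚP.+-identityʳ _) (ℚP.*-identityˡ (h 0))
alt-card h (outside ∷ S) (outside ∷ T) S∩T=∅ =
  trans (alt-∷-outside (λ B → h ∣ B ∣) outside S T) (alt-card h S T (drop-disjoint S∩T=∅))
alt-card h (inside ∷ S)  (outside ∷ T) S∩T=∅ =
  trans (alt-∷-outside (λ B → h ∣ B ∣) inside S T)
    (trans (alt-card (h ∘ suc) S T (drop-disjoint S∩T=∅)) (Δ-shift (∣ T ∣) h ∣ S ∣))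
alt-card h (outside ∷ S) (inside ∷ T)  S∩T=∅ =
  trans (alt-∷-inside (λ B → h ∣ B ∣) outside S T)
    (cong₂ _-_ (alt-card h S T (drop-disjoint S∩T=∅))
      (trans (alt-card (h ∘ suc) S T (drop-disjoint S∩T=∅)) (Δ-shift (∣ T ∣) h ∣ S ∣)))
alt-card h (inside ∷ S)  (inside ∷ T)  S∩T=∅ = ⊥-elim (S∩T=∅ here here)

module _ {n : ℕ} where

  sumOver-cong : ∀ (Q : Subset n) {f g : Fin n → ℚ} → (∀ i → f i ≡ g i) → sumOver Q f ≡ sumOver Q g
  sumOver-cong Q f≗g = cong sumℚ (ListP.map-cong f≗g (filter (_∈? Q) (allFin n)))

  private
   filter-∈?-map-suc : ∀ s (Q : Subset n) xs →
    filter (_∈? (s ∷ Q)) (map suc xs) ≡ map suc (filter (_∈? Q) xs)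
  filter-∈?-map-suc s Q []       = refl
  filter-∈?-map-suc s Q (x ∷ xs) with x ∈? Q
  ... | yes _ = cong (suc x ∷_) (filter-∈?-map-suc s Q xs)
  ... | no  _ = filter-∈?-map-suc s Q xs

  sumOver-∷ : ∀ s (Q : Subset n) (f : Fin (suc n) → ℚ) →
    sumℚ (map f (filter (_∈? (s ∷ Q)) (tabulate suc))) ≡ sumOver Q (f ∘ suc)
  sumOver-∷ s Q f = begin
    sumℚ (map f (filter (_∈? (s ∷ Q)) (tabulate suc)))
      ≡⟨ cong (λ xs → sumℚ (map f (filter (_∈? (s ∷ Q)) xs))) (sym (ListP.map-tabulate id suc)) ⟩
    sumℚ (map f (filter (_∈? (s ∷ Q)) (map suc (allFin n))))
      ≡⟨ cong (sumℚ ∘ map f) (filter-∈?-map-suc s Q (allFin n)) ⟩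
    sumℚ (map f (map suc (filter (_∈? Q) (allFin n))))
      ≡⟨ cong sumℚ (sym (ListP.map-∘ (filter (_∈? Q) (allFin n)))) ⟩
    sumOver Q (f ∘ suc) ∎
    where open ≡-Reasoning

sumOver-inside : ∀ {n} (Q : Subset n) f → sumOver (inside ∷ Q) f ≡ f zero + sumOver Q (f ∘ suc)
sumOver-inside Q f = cong (_+_ (f zero)) (sumOver-∷ inside Q f)

sumOver-outside : ∀ {n} (Q : Subset n) f → sumOver (outside ∷ Q) f ≡ sumOver Q (f ∘ suc)
sumOver-outside Q f = sumOver-∷ outside Q f

sumOver-≤-× : ∀ {n} (Q : Subset n) {f : Fin n → ℚ} {d} → (∀ i → f i ≤ d) → sumOver Q f ≤ ∣ Q ∣ × d
sumOver-≤-× []            f≤d = ℚP.≤-refl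
sumOver-≤-× (inside ∷ Q)  {f} f≤d = subst (_≤ _) (sym (sumOver-inside Q f))
  (ℚP.+-mono-≤ (f≤d zero) (sumOver-≤-× Q (f≤d ∘ suc)))
sumOver-≤-× (outside ∷ Q) {f} f≤d = subst (_≤ _) (sym (sumOver-outside Q f)) (sumOver-≤-× Q (f≤d ∘ suc))

sumOver-≤-support : ∀ {n} (Q S : Subset n) {f : Fin n → ℚ} {d} → 0ℚ ≤ d →
  (∀ {i} → i ∈ S → f i ≤ d) → (∀ {i} → i ∉ S → f i ≤ 0ℚ) → sumOver Q f ≤ ∣ S ∣ × d
sumOver-≤-support [] [] 0≤d _ _ = ℚP.≤-refl
sumOver-≤-support (inside ∷ Q) (inside ∷ S) {f} 0≤d on off =
  subst (_≤ _) (sym (sumOver-inside Q f))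
    (ℚP.+-mono-≤ (on here) (sumOver-≤-support Q S 0≤d (on ∘ there) (off ∘ (_∘ drop-there))))
sumOver-≤-support (inside ∷ Q) (outside ∷ S) {f} {d} 0≤d on off =
  subst₂ _≤_ (sym (sumOver-inside Q f)) (ℚP.+-identityˡ (∣ S ∣ × d))
    (ℚP.+-mono-≤ (off λ ()) (sumOver-≤-support Q S 0≤d (on ∘ there) (off ∘ (_∘ drop-there))))
sumOver-≤-support (outside ∷ Q) (inside ∷ S) {f} {d} 0≤d on off =
  subst (_≤ _) (sym (sumOver-outside Q f))
    (ℚP.≤-trans (sumOver-≤-support Q S 0≤d (on ∘ there) (off ∘ (_∘ drop-there)))
      (subst (_≤ d + ∣ S ∣ × d) (ℚP.+-identityˡ (∣ S ∣ × d)) (ℚP.+-monoˡ-≤ (∣ S ∣ × d) 0≤d)))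
sumOver-≤-support (outside ∷ Q) (outside ∷ S) {f} 0≤d on off =
  subst (_≤ _) (sym (sumOver-outside Q f))
    (sumOver-≤-support Q S 0≤d (on ∘ there) (off ∘ (_∘ drop-there)))

∣p∣<∣p∪⁅x⁆∣ : ∀ {n} {p : Subset n} {x} → x ∉ p → ∣ p ∣ ℕ.< ∣ p ∪ ⁅ x ⁆ ∣
∣p∣<∣p∪⁅x⁆∣ {x = x} x∉p = p⊂q⇒∣p∣<∣q∣ (p⊆p∪q ⁅ x ⁆ , x , x∈p∪q⁺ (inj₂ (x∈⁅x⁆ x)) , x∉p)

1≤∣p∪⁅x⁆∣ : ∀ {n} (p : Subset n) x → 1 ℕ.≤ ∣ p ∪ ⁅ x ⁆ ∣
1≤∣p∪⁅x⁆∣ p x = subst (ℕ._≤ ∣ p ∪ ⁅ x ⁆ ∣) (∣⁅x⁆∣≡1 x) (∣q∣≤∣p∪q∣ p ⁅ x ⁆)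

altᵢ-card : ∀ {n} (h : ℕ → ℚ) (S T : Subset n) → (∀ {x} → x ∈ S → x ∉ T) → ∀ i →
  altᵢ (λ B → h ∣ B ∣) S T i ≡ 0ℚ ⊎ altᵢ (λ B → h ∣ B ∣) S T i ≡ Δ (∣ T ∣) h ∣ S ∪ ⁅ i ⁆ ∣
altᵢ-card h S T S∩T=∅ i with i ∈? T
... | yes i∈T = inj₁ (trans (alt-∪ʳ (λ B → h ∣ B ∣) S T ⁅ i ⁆)
                        (alt-vanishes (λ B → h ∣ B ∣) (S ∪ ⁅ i ⁆) T (x∈p∪q⁺ (inj₂ (x∈⁅x⁆ i))) i∈T))
... | no  i∉T = inj₂ (trans (alt-∪ʳ (λ B → h ∣ B ∣) S T ⁅ i ⁆) (alt-card h (S ∪ ⁅ i ⁆) T S∪i∩T=∅))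
  where
  S∪i∩T=∅ : ∀ {x} → x ∈ S ∪ ⁅ i ⁆ → x ∉ T
  S∪i∩T=∅ x∈S∪i = [ S∩T=∅ , (λ x∈i → subst (_∉ T) (sym (x∈⁅y⁆⇒x≡y i x∈i)) i∉T) ] (x∈p∪q⁻ S ⁅ i ⁆ x∈S∪i)

feasible-cong : ∀ {n ℓ} {G : Graph n} {y y′ : Subset n → ℚ} →
  (∀ A → y A ≡ y′ A) → FeasibleSA⁺ ℓ G y → FeasibleSA⁺ ℓ G y′
feasible-cong {y = y} {y′} y≗y′ (y∅≡1 , feasible) =
  trans (sym (y≗y′ ⊥)) y∅≡1 , λ S T S∩T≡⊥ ∣S∪T∣≤ℓ →
  let (clique , nonNeg , nonNegᵢ) = feasible S T S∩T≡⊥ ∣S∪T∣≤ℓ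
      alt≡ = alt-cong y≗y′ S T
      altᵢ≡ = λ i → alt-cong (λ B → y≗y′ (B ∪ ⁅ i ⁆)) S T
  in (λ Q isClique → subst₂ (λ a b → 0ℚ ≤ a - b) alt≡ (sumOver-cong Q altᵢ≡) (clique Q isClique))
   , subst (0ℚ ≤_) alt≡ nonNeg
   , (λ i → subst (0ℚ ≤_) (altᵢ≡ i) (nonNegᵢ i))

module _ {n} (G : Graph n) (ℓ ω : ℕ) (clique-bound : ∀ Q → IsClique G Q → ∣ Q ∣ ℕ.≤ ω)
         {c : ℚ} (0≤c : 0ℚ ≤ c) ([ω+ℓ]c≤1 : (ω ℕ.+ ℓ) × c ≤ 1ℚ) where

  private
    y : Subset n → ℚ
    y A = profile c ∣ A ∣

  module _ (S T : Subset n) (S∩T=∅ : ∀ {x} → x ∈ S → x ∉ T) (∣T∣≤ℓ : ∣ T ∣ ℕ.≤ ℓ) where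

    private
      t : ℕ
      t = ∣ T ∣

      ωc+ℓc≤1 : ω × c + ℓ × c ≤ 1ℚ
      ωc+ℓc≤1 = subst (_≤ 1ℚ) (×-homo-+ c ω ℓ) [ω+ℓ]c≤1

      tc≤ℓc : t × c ≤ ℓ × c
      tc≤ℓc = ×-monoˡ-≤ 0≤c ∣T∣≤ℓ

      tc≤1 : t × c ≤ 1ℚ
      tc≤1 = ℚP.≤-trans (×-monoˡ-≤ 0≤c (ℕP.≤-trans ∣T∣≤ℓ (ℕP.m≤n+m ℓ ω))) [ω+ℓ]c≤1

      altᵢ-satisfies : (P : ℚ → Set) → P 0ℚ → (∀ a → 1 ℕ.≤ a → P (Δ t (profile c) a)) →
        ∀ i → P (altᵢ y S T i)
      altᵢ-satisfies P p0 pΔ i =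
        [ (λ e → subst P (sym e) p0) , (λ e → subst P (sym e) (pΔ _ (1≤∣p∪⁅x⁆∣ S i))) ]
          (altᵢ-card (profile c) S T S∩T=∅ i)

    altᵢ-nonNeg : ∀ i → 0ℚ ≤ altᵢ y S T i
    altᵢ-nonNeg = altᵢ-satisfies (0ℚ ≤_) ℚP.≤-refl (λ a _ → Δ-profile-nonNeg 0≤c t tc≤1 a)

    altᵢ-≤ : ∀ i → altᵢ y S T i ≤ c
    altᵢ-≤ = altᵢ-satisfies (_≤ c) 0≤c (λ _ 1≤a → Δ-profile-≤ 0≤c t 1≤a)

    altᵢ-nonPos : ∀ i → 2 ℕ.≤ ∣ S ∪ ⁅ i ⁆ ∣ → altᵢ y S T i ≤ 0ℚ
    altᵢ-nonPos i 2≤∣S∪i∣ with altᵢ-card (profile c) S T S∩T=∅ i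
    ... | inj₁ e = ℚP.≤-reflexive e
    ... | inj₂ e = ℚP.≤-reflexive (trans e (Δ-profile-≥2 t 2≤∣S∪i∣))

    sumOver-altᵢ-≤ : ∀ Q → ∣ Q ∣ ℕ.≤ ω → sumOver Q (altᵢ y S T) ≤ Δ t (profile c) ∣ S ∣
    sumOver-altᵢ-≤ Q ∣Q∣≤ω with ∣ S ∣ in ∣S∣≡
    ... | zero = subst (Σ ≤_) (sym (Δ-profile-0 t)) (p+q≤r⇒p≤r-q (ℚP.≤-trans
          (ℚP.+-mono-≤ (ℚP.≤-trans (sumOver-≤-× Q altᵢ-≤) (×-monoˡ-≤ 0≤c ∣Q∣≤ω)) tc≤ℓc) ωc+ℓc≤1))
      where Σ = sumOver Q (altᵢ y S T)
    ... | suc zero = subst (Σ ≤_) (trans (trans (cong (_× c) ∣S∣≡) (×-homo-1 c)) (sym (Δ-profile-1 t)))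
          (sumOver-≤-support Q S 0≤c (λ {i} _ → altᵢ-≤ i) (λ {i} i∉S → altᵢ-nonPos i (2≤∣S∪i∣ i∉S)))
      where
      Σ = sumOver Q (altᵢ y S T)
      2≤∣S∪i∣ : ∀ {i} → i ∉ S → 2 ℕ.≤ ∣ S ∪ ⁅ i ⁆ ∣
      2≤∣S∪i∣ {i} i∉S = subst (λ k → suc k ℕ.≤ ∣ S ∪ ⁅ i ⁆ ∣) ∣S∣≡ (∣p∣<∣p∪⁅x⁆∣ i∉S)
    ... | suc (suc _) = subst (Σ ≤_) (trans (×-zeroʳ ∣ Q ∣) (sym (Δ-profile-≥2 t 2≤2+k)))
          (sumOver-≤-× Q (λ i → altᵢ-nonPos i (ℕP.≤-trans 2≤∣S∣ (∣p∣≤∣p∪q∣ S ⁅ i ⁆))))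
      where
      Σ = sumOver Q (altᵢ y S T)
      2≤2+k = s≤s (s≤s z≤n)
      2≤∣S∣ = subst (2 ℕ.≤_) (sym ∣S∣≡) 2≤2+k

    alt≡Δ : alt y S T ≡ Δ t (profile c) ∣ S ∣
    alt≡Δ = alt-card (profile c) S T S∩T=∅

    alt-nonNeg : 0ℚ ≤ alt y S T
    alt-nonNeg = subst (0ℚ ≤_) (sym alt≡Δ) (Δ-profile-nonNeg 0≤c t tc≤1 ∣ S ∣)

    clique-constraint : ∀ Q → ∣ Q ∣ ℕ.≤ ω → 0ℚ ≤ alt y S T - sumOver Q (altᵢ y S T)
    clique-constraint Q ∣Q∣≤ω = subst (λ a → 0ℚ ≤ a - sumOver Q (altᵢ y S T)) (sym alt≡Δ)
      (p≤q⇒0≤q-p (sumOver-altᵢ-≤ Q ∣Q∣≤ω))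

  profile-feasible : FeasibleSA⁺ ℓ G y
  profile-feasible = cong (profile c) (∣⊥∣≡0 n) , λ S T S∩T≡⊥ ∣S∪T∣≤ℓ →
    let S∩T=∅ : ∀ {x} → x ∈ S → x ∉ T
        S∩T=∅ x∈S x∈T = ∉⊥ (subst (_ ∈_) S∩T≡⊥ (x∈p∩q⁺ (x∈S , x∈T)))
        ∣T∣≤ℓ = ℕP.≤-trans (∣q∣≤∣p∪q∣ S T) ∣S∪T∣≤ℓ
    in (λ Q isClique → clique-constraint S T S∩T=∅ ∣T∣≤ℓ Q (clique-bound Q isClique))
     , alt-nonNeg S T S∩T=∅ ∣T∣≤ℓ
     , altᵢ-nonNeg S T S∩T=∅ ∣T∣≤ℓ

ŷ≡profile : ∀ {n} ω ℓ .{{_ : NonZero ℓ}} (A : Subset n) →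
  ŷ ω ℓ A ≡ profile (_/_ (+ 1) (ω ℕ.+ ℓ) {{+-nonZero ω ℓ}}) ∣ A ∣
ŷ≡profile ω ℓ A with ∣ A ∣
... | zero        = refl
... | suc zero    = refl
... | suc (suc _) = refl

lemma2 : ∀ {n} (G : Graph n) (ℓ : ℕ) .{{_ : NonZero ℓ}} (ω : ℕ) →
    IsCliqueNumber G ω → FeasibleSA⁺ ℓ G (ŷ ω ℓ)
lemma2 G ℓ ω (_ , clique-bound) =
  feasible-cong {G = G} (λ A → sym (ŷ≡profile ω ℓ A))
    (profile-feasible G ℓ ω clique-bound 0≤c (ℚP.≤-reflexive (×-inverse (ω ℕ.+ ℓ) {{+-nonZero ω ℓ}})))
  where
  c : ℚ
  c = _/_ (+ 1) (ω ℕ.+ ℓ) {{+-nonZero ω ℓ}}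

  0≤c : 0ℚ ≤ c
  0≤c = ℚP.nonNegative⁻¹ _ {{ℚP.normalize-nonNeg 1 (ω ℕ.+ ℓ) {{+-nonZero ω ℓ}}}}
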